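{- Let $r\ge 2$ and $k\ge 2$. Let $\mathcal{H}$ be a family of $k$-graphs and let $F$ be a $(k-1)$-graph such that for all $H\in \mathcal{H}$ the link graph of every vertex in $H$ contains a copy of $F$. Then \[\hat{R}_r(\mathcal{H})\geq \frac{1}{k}\,\hat{R}_r(F)\cdot R_r(\mathcal{H}).\]
   Context: A $k$-graph is a $k$-uniform hypergraph. For a $k$-graph $H$ and $v\in V(H)$, the link graph of $v$ in $H$ is the $(k-1)$-graph on $V(H)$ whose edges are the $(k-1)$-sets $e$ with $e\cup\{v\}\in E(H)$. For a $k$-graph $G$ and a family $\mathcal{H}$ of $k$-graphs, $G\to_r\mathcal{H}$ means every $r$-coloring of the edges of $G$ contains a monochromatic copy of some member of $\mathcal{H}$; $\hat R_r(\mathcal{H})$ (resp. $R_r(\mathcal{H})$) is the minimum number of edges (resp. vertices) of a $k$-graph $G$ with $G\to_r\mathcal{H}$. For a single hypergraph $F$, $\hat R_r(F)=\hat R_r(\{F\})$. -}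

module Defs where

open import Data.Nat using (ℕ; _≤_; _∸_)
open import Data.Fin using (Fin)
open import Data.Fin.Subset using (Subset; ∣_∣; ⁅_⁆; _∪_; _∉_)
import Data.Fin.Subset as S
open import Data.List using (List; length)
open import Data.List.Relation.Unary.All using (All)
open import Data.List.Relation.Unary.Unique.Propositional using (Unique)
import Data.List.Membership.Propositional as L
open import Data.Product using (Σ; ∃; _×_; ∃-syntax)
open import Function.Definitions using (Injective)
open import Function.Bundles using (_⇔_)
open import Relation.Binary.PropositionalEquality using (_≡_)

record KGraph (k : ℕ) : Set where
  field
    V       : ℕ
    edges   : List (Subset V)
    unique  : Unique edges
    uniform : All (λ e → ∣ e ∣ ≡ k) edges
open KGraph public

e : ∀ {k} → KGraph k → ℕ
e G = length (edges G)

IsImage : ∀ {n m} → (Fin n → Fin m) → Subset n → Subset m → Set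
IsImage f s t = ∀ y → (y S.∈ t) ⇔ (∃[ x ] (x S.∈ s × f x ≡ y))

CopyIn : ∀ {j} (F : KGraph j) {m : ℕ} → (Subset m → Set) → Set
CopyIn F {m} P =
  Σ (Fin (V F) → Fin m) λ f → Injective _≡_ _≡_ f ×
    (∀ s → s L.∈ edges F → ∃[ t ] (IsImage f s t × P t))

LinkEdge : ∀ {k} (H : KGraph k) → Fin (V H) → Subset (V H) → Set
LinkEdge {k} H v t = ∣ t ∣ ≡ k ∸ 1 × (t ∪ ⁅ v ⁆) L.∈ edges H

Family : ℕ → Set₁
Family k = KGraph k → Set

-- r-colourings of the edges of G (only the values on edges matter).
Colouring : ∀ {k} → ℕ → KGraph k → Set
Colouring r G = Subset (V G) → Fin r

Arrows : ∀ {k} (G : KGraph k) (r : ℕ) (ℋ : Family k) → Set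
Arrows G r ℋ = (c : Colouring r G) →
  ∃[ H ] (ℋ H × ∃[ i ] CopyIn H (λ t → t L.∈ edges G × c t ≡ i))

IsSizeRamsey : ∀ {k} (r : ℕ) (ℋ : Family k) → ℕ → Set
IsSizeRamsey {k} r ℋ m =
  (∃[ G ] (Arrows G r ℋ × e G ≡ m)) × (∀ (G : KGraph k) → Arrows G r ℋ → m ≤ e G)

IsRamsey : ∀ {k} (r : ℕ) (ℋ : Family k) → ℕ → Set
IsRamsey {k} r ℋ m =
  (∃[ G ] (Arrows G r ℋ × V G ≡ m)) × (∀ (G : KGraph k) → Arrows G r ℋ → m ≤ V G)

-- Let G →ᵣ ℋ have R̂ᵣ(ℋ) edges and let U be the set of vertices whose link graph arrows F; each of
-- them has degree at least R̂ᵣ(F). The induced graph G[U] still arrows ℋ: given a colouring of G[U]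
-- with no monochromatic member of ℋ, colour every other edge T of G by the bad colouring of the link
-- of the least vertex w ∈ T ∖ U, applied to T − w. A monochromatic copy of H ∈ ℋ cannot lie inside U,
-- and if x is the vertex of H whose image is the least one outside U, the copy of F in the link of x
-- becomes a monochromatic copy of F in the link of w. So |U| ≥ Rᵣ(ℋ), and double counting gives
-- k · e(G) = Σ deg ≥ |U| · R̂ᵣ(F).
-- Whether a link arrows F is not decidable, so the argument runs in the double-negation monad; this
-- is harmless because colourings of a finite graph form a finite set and the conclusion is decidable.

module Submission where

open import Defs
open import Level using (0ℓ)
open import Effect.Monad using (RawMonad)
open import Data.Nat using (ℕ; zero; suc; _≤_; _*_; _∸_; _+_; _≤?_; z≤n; s≤s)
open import Data.Nat.Properties
  using ( +-mono-≤; ≤-trans; ≤-reflexive; m≤n+m; *-comm; *-monoˡ-≤; 1+n≢n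
        ; +-0-commutativeMonoid; module ≤-Reasoning)
open import Data.Bool using (Bool; true; false; if_then_else_)
import Data.Bool.Properties as Bool
open import Data.Fin using (Fin; zero; suc; _<_; _≟_)
open import Data.Fin.Properties using (suc-injective; any?)
open import Data.Fin.Subset using (Subset; inside; outside; ∣_∣; ⁅_⁆; _∪_; _-_; _∈_; _∉_; _⊆_)
open import Data.Fin.Subset.Properties
  using ( _∈?_; _⊆?_; ⊆-antisym; p─q⊆p; x∈p∧x≢y⇒x∈p-y; p─⊥≡p; x∈⁅x⁆; x∈⁅y⁆⇒x≡y
        ; x∈p∪q⁻; p⊆p∪q; q⊆p∪q; drop-∷-⊆)
open import Data.Vec using ([]; _∷_; here; there; tabulate)
open import Data.Vec.Properties using (≡-dec; lookup∘tabulate; []=⇒lookup; lookup⇒[]=)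
open import Data.List using (List; []; _∷_; length; map; filter)
open import Data.List.Properties using (length-map)
open import Data.List.Relation.Unary.All using (All; []; _∷_)
import Data.List.Relation.Unary.All as All
import Data.List.Relation.Unary.All.Properties as All
open import Data.List.Relation.Unary.Any using (here; there)
open import Data.List.Relation.Unary.Unique.Propositional using (Unique)
open import Data.List.Relation.Unary.AllPairs using ([]; _∷_)
import Data.List.Relation.Unary.Unique.Propositional.Properties as Unique
open import Data.List.Membership.Propositional using () renaming (_∈_ to _∈ᴸ_)
open import Data.List.Membership.Propositional.Properties using (∈-map⁺; ∈-filter⁺)
open import Data.Maybe using (Maybe; just; nothing)
import Data.Maybe as Maybe
open import Data.Product using (Σ; _×_; ∃-syntax; _,_; proj₁; proj₂)
open import Data.Sum using (_⊎_; inj₁; inj₂; [_,_]′)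
open import Function using (_∘_; mk⇔; Injective)
open import Function.Bundles using (Equivalence)
open import Relation.Unary using (Pred; Decidable)
open import Relation.Binary.Definitions using (DecidableEquality)
open import Relation.Binary.PropositionalEquality
  using (_≡_; _≢_; refl; sym; trans; cong; cong₂; subst; module ≡-Reasoning)
open import Relation.Nullary using (¬_; yes; no; does; ¬?; contradiction)
open import Relation.Nullary.Decidable using (decidable-stable; _×-dec_)
open import Relation.Nullary.Negation using (¬¬-Monad)
open import Algebra.Properties.CommutativeMonoid.Sum +-0-commutativeMonoid
  using (sum-syntax; ∑-distrib-+; sum-cong-≗; sum-replicate-zero)

open RawMonad (¬¬-Monad {a = 0ℓ}) using (return; _>>=_)
open Equivalence using (to; from)

¬¬-pull-Fin : ∀ n {P : Fin n → Set} → (∀ i → ¬ ¬ P i) → ¬ ¬ (∀ i → P i)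
¬¬-pull-Fin zero    h = return λ ()
¬¬-pull-Fin (suc n) h = do
  p₀ ← h zero
  ps ← ¬¬-pull-Fin n (h ∘ suc)
  return λ { zero → p₀ ; (suc i) → ps i }

AgreeOn : ∀ {A : Set} {r} → List A → (A → Fin r) → (A → Fin r) → Set
AgreeOn xs c c′ = ∀ {x} → x ∈ᴸ xs → c x ≡ c′ x

DependsOnlyOn : ∀ {A : Set} {r} → List A → ((A → Fin r) → Set) → Set
DependsOnlyOn xs P = ∀ {c c′} → AgreeOn xs c c′ → P c → P c′

module _ {A : Set} (_≟ᴬ_ : DecidableEquality A) where

  recolour : ∀ {r} → (A → Fin r) → A → Fin r → A → Fin r
  recolour c x i y = if does (y ≟ᴬ x) then i else c y

  recolour-self : ∀ {r} (c : A → Fin r) x y → recolour c x (c x) y ≡ c y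
  recolour-self c x y with y ≟ᴬ x
  ... | yes refl = refl
  ... | no _     = refl

  recolour-agree : ∀ {r xs} {c c′ : A → Fin r} x i → AgreeOn xs c c′ →
                   AgreeOn (x ∷ xs) (recolour c x i) (recolour c′ x i)
  recolour-agree x i c≈c′ {y} y∈ with y ≟ᴬ x | y∈
  ... | yes _  | _          = refl
  ... | no y≢x | here y≡x   = contradiction y≡x y≢x
  ... | no _   | there y∈xs = c≈c′ y∈xs

  ¬¬-pull-colourings : ∀ {r} xs (P : (A → Fin (suc r)) → Set) → DependsOnlyOn xs P →
                       (∀ c → ¬ ¬ P c) → ¬ ¬ (∀ c → P c)
  ¬¬-pull-colourings []           P P-resp h = do
    p ← h (λ _ → zero)
    return λ c → P-resp (λ ()) p
  ¬¬-pull-colourings {r} (x ∷ xs) P P-resp h = do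
    all-recoloured ← ¬¬-pull-colourings xs P′ P′-resp (λ c → ¬¬-pull-Fin (suc r) (h ∘ recolour c x))
    return λ c → P-resp (λ {y} _ → recolour-self c x y) (all-recoloured c (c x))
    where
    P′ : (A → Fin (suc r)) → Set
    P′ c = ∀ i → P (recolour c x i)
    P′-resp : DependsOnlyOn xs P′
    P′-resp c≈c′ p′ i = P-resp (recolour-agree x i c≈c′) (p′ i)

IsCopy : ∀ {j} (F : KGraph j) {m} → (Fin (V F) → Fin m) → (Subset m → Set) → Set
IsCopy F f P = Injective _≡_ _≡_ f × (∀ s → s ∈ᴸ edges F → ∃[ t ] (IsImage f s t × P t))

module _ {j m} {F : KGraph j} {f : Fin (V F) → Fin m} {P Q : Subset m → Set} where

  IsCopy-map : (∀ {s t} → IsImage f s t → P t → Q t) → IsCopy F f P → IsCopy F f Q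
  IsCopy-map P⇒Q (f-inj , f-edges) = f-inj , λ s s∈F →
    let (t , s↦t , Pt) = f-edges s s∈F in t , s↦t , P⇒Q s↦t Pt

copy-map : ∀ {j m} (F : KGraph j) {P Q : Subset m → Set} → (∀ {t} → P t → Q t) → CopyIn F P → CopyIn F Q
copy-map F P⇒Q (f , f-copy) = f , IsCopy-map {F = F} (λ _ → P⇒Q) f-copy

InRange : ∀ {i j} → (Fin i → Fin j) → Fin j → Set
InRange f y = ∃[ x ] f x ≡ y

inRange? : ∀ {i j} (f : Fin i → Fin j) → Decidable (InRange f)
inRange? f y = any? (λ x → f x ≟ y)

image⊆range : ∀ {n m} {f : Fin n → Fin m} {s t} → IsImage f s t → ∀ {y} → y ∈ t → InRange f y
image⊆range s↦t {y} y∈t = let (x , _ , fx≡y) = to (s↦t y) y∈t in x , fx≡y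

MonoEdge : ∀ {k r} (G : KGraph k) → Colouring r G → Fin r → Subset (V G) → Set
MonoEdge G c i t = t ∈ᴸ edges G × c t ≡ i

MonoCopy : ∀ {k r} (G : KGraph k) → Family k → Colouring r G → Set
MonoCopy G ℋ c = ∃[ H ] (ℋ H × ∃[ i ] CopyIn H (MonoEdge G c i))

BadColouring : ∀ {k} (r : ℕ) (G : KGraph k) → Family k → Set
BadColouring r G ℋ = Σ (Colouring r G) λ c → ¬ MonoCopy G ℋ c

_≟ˢ_ : ∀ {n} → DecidableEquality (Subset n)
_≟ˢ_ = ≡-dec Bool._≟_

arrows-or-bad : ∀ {k r} (G : KGraph k) (ℋ : Family k) →
                ¬ ¬ (Arrows G (suc r) ℋ ⊎ BadColouring (suc r) G ℋ)
arrows-or-bad G ℋ ¬both =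
  ¬¬-pull-colourings _≟ˢ_ (edges G) (MonoCopy G ℋ) MonoCopy-resp
    (λ c ¬mono → ¬both (inj₂ (c , ¬mono))) (¬both ∘ inj₁)
  where
  MonoCopy-resp : DependsOnlyOn (edges G) (MonoCopy G ℋ)
  MonoCopy-resp c≈c′ (H , H∈ℋ , i , copy) =
    H , H∈ℋ , i , copy-map H (λ (t∈G , ct≡i) → t∈G , trans (sym (c≈c′ t∈G)) ct≡i) copy

Unique-map⁺ : ∀ {A B : Set} {P : A → Set} {xs} (f : A → B) →
              (∀ {x y} → P x → P y → f x ≡ f y → x ≡ y) → All P xs → Unique xs → Unique (map f xs)
Unique-map⁺ f f-inj []         []           = []
Unique-map⁺ f f-inj (px ∷ pxs) (x∉xs ∷ xs!) =
  All.map⁺ (All.zipWith (λ (py , x≢y) fx≡fy → x≢y (f-inj px py fx≡fy)) (pxs , x∉xs))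
  ∷ Unique-map⁺ f f-inj pxs xs!

module _ {k k′} (G : KGraph k) {P : Pred (Subset (V G)) 0ℓ} (P? : Decidable P) {m} (φ : Subset (V G) → Subset m)
         (φ-inj : ∀ {T T′} → P T → P T′ → φ T ≡ φ T′ → T ≡ T′)
         (φsize-minus : ∀ {T} → P T → ∣ T ∣ ≡ k → ∣ φ T ∣ ≡ k′) where

  mapFilterEdges : KGraph k′
  mapFilterEdges = record
    { V       = m
    ; edges   = map φ (filter P? (edges G))
    ; unique  = Unique-map⁺ φ φ-inj (All.all-filter P? (edges G)) (Unique.filter⁺ P? (unique G))
    ; uniform = All.map⁺ (All.zipWith (λ (PT , ∣T∣≡k) → φsize-minus PT ∣T∣≡k)
                            (All.all-filter P? (edges G) , All.filter⁺ P? (uniform G)))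
    }

  ∈-mapFilterEdges : ∀ {T} → T ∈ᴸ edges G → P T → φ T ∈ᴸ edges mapFilterEdges
  ∈-mapFilterEdges T∈G PT = ∈-map⁺ φ (∈-filter⁺ P? T∈G PT)

  e-mapFilterEdges : e mapFilterEdges ≡ length (filter P? (edges G))
  e-mapFilterEdges = length-map φ (filter P? (edges G))

x∉p-x : ∀ {n} (p : Subset n) x → x ∉ p - x
x∉p-x (_ ∷ p) zero    ()
x∉p-x (_ ∷ p) (suc x) (there x∈p-x) = x∉p-x p x x∈p-x

x∈p-y⇒x≢y : ∀ {n} {p : Subset n} {x y} → x ∈ p - y → x ≢ y
x∈p-y⇒x≢y {p = p} {x} x∈p-x refl = x∉p-x p x x∈p-x

x∈p⇒∣p∣≡1+∣p-x∣ : ∀ {n} {p : Subset n} {x} → x ∈ p → ∣ p ∣ ≡ suc ∣ p - x ∣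
x∈p⇒∣p∣≡1+∣p-x∣ {p = inside ∷ p}  {zero}  here          = cong (suc ∘ ∣_∣) (sym (p─⊥≡p p))
x∈p⇒∣p∣≡1+∣p-x∣ {p = inside ∷ p}  {suc x} (there x∈p) = cong suc (x∈p⇒∣p∣≡1+∣p-x∣ x∈p)
x∈p⇒∣p∣≡1+∣p-x∣ {p = outside ∷ p} {suc x} (there x∈p) = x∈p⇒∣p∣≡1+∣p-x∣ x∈p

x∈p⇒p∪⁅x⁆≡p : ∀ {n} {p : Subset n} {x} → x ∈ p → p ∪ ⁅ x ⁆ ≡ p
x∈p⇒p∪⁅x⁆≡p {p = p} {x} x∈p = ⊆-antisym
  (λ y∈ → [ (λ y∈p → y∈p) , (λ y∈⁅x⁆ → subst (_∈ p) (sym (x∈⁅y⁆⇒x≡y x y∈⁅x⁆)) x∈p) ]′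
             (x∈p∪q⁻ p ⁅ x ⁆ y∈))
  (p⊆p∪q ⁅ x ⁆)

-‿injective : ∀ {n v} {T T′ : Subset n} → v ∈ T → v ∈ T′ → T - v ≡ T′ - v → T ≡ T′
-‿injective {v = v} v∈T v∈T′ T-v≡T′-v =
  ⊆-antisym (⊆-from v∈T′ T-v≡T′-v) (⊆-from v∈T (sym T-v≡T′-v))
  where
  ⊆-from : ∀ {A B} → v ∈ B → A - v ≡ B - v → A ⊆ B
  ⊆-from v∈B A-v≡B-v {x} x∈A with x ≟ v
  ... | yes refl = v∈B
  ... | no x≢v   = p─q⊆p _ _ (subst (x ∈_) A-v≡B-v (x∈p∧x≢y⇒x∈p-y x∈A x≢v))

∣p-x∣≡∣p∣∸1 : ∀ {n} {p : Subset n} {x} → x ∈ p → ∣ p - x ∣ ≡ ∣ p ∣ ∸ 1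
∣p-x∣≡∣p∣∸1 x∈p = cong (_∸ 1) (sym (x∈p⇒∣p∣≡1+∣p-x∣ x∈p))

degree : ∀ {k} (G : KGraph k) → Fin (V G) → ℕ
degree G v = length (filter (v ∈?_) (edges G))

module _ {k} (G : KGraph k) (v : Fin (V G)) where

  private
    size-minus : ∀ {T} → v ∈ T → ∣ T ∣ ≡ k → ∣ T - v ∣ ≡ k ∸ 1
    size-minus v∈T ∣T∣≡k = trans (∣p-x∣≡∣p∣∸1 v∈T) (cong (_∸ 1) ∣T∣≡k)

  link : KGraph (k ∸ 1)
  link = mapFilterEdges G (v ∈?_) (_- v) -‿injective size-minus

  ∈-link : ∀ {T} → T ∈ᴸ edges G → v ∈ T → T - v ∈ᴸ edges link
  ∈-link = ∈-mapFilterEdges G (v ∈?_) (_- v) -‿injective size-minus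

  e-link : e link ≡ degree G v
  e-link = e-mapFilterEdges G (v ∈?_) (_- v) -‿injective size-minus

embed : ∀ {n} (U : Subset n) → Fin ∣ U ∣ → Fin n
embed (inside  ∷ U) zero    = zero
embed (inside  ∷ U) (suc y) = suc (embed U y)
embed (outside ∷ U) y       = suc (embed U y)

restrict : ∀ {n} (U : Subset n) → Subset n → Subset ∣ U ∣
restrict []            []      = []
restrict (inside  ∷ U) (b ∷ s) = b ∷ restrict U s
restrict (outside ∷ U) (_ ∷ s) = restrict U s

embed-injective : ∀ {n} (U : Subset n) → Injective _≡_ _≡_ (embed U)
embed-injective (inside  ∷ U) {zero}  {zero}  _  = refl
embed-injective (inside  ∷ U) {suc y} {suc z} eq = cong suc (embed-injective U (suc-injective eq))
embed-injective (outside ∷ U)                 eq = embed-injective U (suc-injective eq)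

embed-surjective : ∀ {n} (U : Subset n) {x} → x ∈ U → ∃[ y ] embed U y ≡ x
embed-surjective (inside  ∷ U) here        = zero , refl
embed-surjective (inside  ∷ U) (there x∈U) = let (y , eq) = embed-surjective U x∈U in suc y , cong suc eq
embed-surjective (outside ∷ U) (there x∈U) = let (y , eq) = embed-surjective U x∈U in y , cong suc eq

∈-restrict⁺ : ∀ {n} (U s : Subset n) {y} → embed U y ∈ s → y ∈ restrict U s
∈-restrict⁺ (inside  ∷ U) (_ ∷ s) {zero}  here      = here
∈-restrict⁺ (inside  ∷ U) (_ ∷ s) {suc y} (there m) = there (∈-restrict⁺ U s m)
∈-restrict⁺ (outside ∷ U) (_ ∷ s)         (there m) = ∈-restrict⁺ U s m

∈-restrict⁻ : ∀ {n} (U s : Subset n) {y} → y ∈ restrict U s → embed U y ∈ s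
∈-restrict⁻ (inside  ∷ U) (_ ∷ s) {zero}  here      = here
∈-restrict⁻ (inside  ∷ U) (_ ∷ s) {suc y} (there m) = there (∈-restrict⁻ U s m)
∈-restrict⁻ (outside ∷ U) (_ ∷ s)         m         = there (∈-restrict⁻ U s m)

∣restrict∣ : ∀ {n} (U s : Subset n) → s ⊆ U → ∣ restrict U s ∣ ≡ ∣ s ∣
∣restrict∣ []            []            _   = refl
∣restrict∣ (inside  ∷ U) (inside  ∷ s) s⊆U = cong suc (∣restrict∣ U s (drop-∷-⊆ s⊆U))
∣restrict∣ (inside  ∷ U) (outside ∷ s) s⊆U = ∣restrict∣ U s (drop-∷-⊆ s⊆U)
∣restrict∣ (outside ∷ U) (outside ∷ s) s⊆U = ∣restrict∣ U s (drop-∷-⊆ s⊆U)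
∣restrict∣ (outside ∷ U) (inside  ∷ s) s⊆U with s⊆U here
... | ()

restrict-injective : ∀ {n} (U : Subset n) {s s′} → s ⊆ U → s′ ⊆ U →
                     restrict U s ≡ restrict U s′ → s ≡ s′
restrict-injective U s⊆U s′⊆U eq = ⊆-antisym (⊆-from s⊆U eq) (⊆-from s′⊆U (sym eq))
  where
  ⊆-from : ∀ {A B} → A ⊆ U → restrict U A ≡ restrict U B → A ⊆ B
  ⊆-from {A} {B} A⊆U eq′ x∈A =
    let (y , y↦x) = embed-surjective U (A⊆U x∈A) in
    subst (_∈ B) y↦x (∈-restrict⁻ U B (subst (_ ∈_) eq′ (∈-restrict⁺ U A (subst (_∈ A) (sym y↦x) x∈A))))

module _ {k} (G : KGraph k) (U : Subset (V G)) where

  private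
    restrictsize-minus : ∀ {T} → T ⊆ U → ∣ T ∣ ≡ k → ∣ restrict U T ∣ ≡ k
    restrictsize-minus T⊆U = trans (∣restrict∣ U _ T⊆U)

  induced : KGraph k
  induced = mapFilterEdges G (_⊆? U) (restrict U) (restrict-injective U) restrictsize-minus

  ∈-induced : ∀ {T} → T ∈ᴸ edges G → T ⊆ U → restrict U T ∈ᴸ edges induced
  ∈-induced = ∈-mapFilterEdges G (_⊆? U) (restrict U) (restrict-injective U) restrictsize-minus

module _ {n j} {U : Subset n} {f : Fin j → Fin n} {f′ : Fin j → Fin ∣ U ∣}
         (f′↦f : ∀ x → embed U (f′ x) ≡ f x) where

  IsImage-restrict : ∀ {s t} → IsImage f s t → IsImage f′ s (restrict U t)
  IsImage-restrict {s} {t} s↦t y = mk⇔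
    (λ y∈ → let (x , x∈s , fx≡) = to (s↦t (embed U y)) (∈-restrict⁻ U t y∈) in
            x , x∈s , embed-injective U (trans (f′↦f x) fx≡))
    (λ { (x , x∈s , refl) →
            ∈-restrict⁺ U t (subst (_∈ t) (sym (f′↦f x)) (from (s↦t (f x)) (x , x∈s , refl))) })

copy-induced : ∀ {j n} {H : KGraph j} {f : Fin (V H) → Fin n} {P : Subset n → Set} (U : Subset n)
               {Q : Subset ∣ U ∣ → Set} → (∀ {t} → t ⊆ U → P t → Q (restrict U t)) →
               (∀ x → f x ∈ U) → IsCopy H f P → CopyIn H Q
copy-induced {H = H} {f = f} {P} U {Q} P⇒Q f∈U (f-inj , f-edges) = f′ , f′-inj , f′-edges
  where
  f′ : Fin (V H) → Fin ∣ U ∣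
  f′ x = proj₁ (embed-surjective U (f∈U x))
  f′↦f : ∀ x → embed U (f′ x) ≡ f x
  f′↦f x = proj₂ (embed-surjective U (f∈U x))
  f′-inj : Injective _≡_ _≡_ f′
  f′-inj {x} {x′} eq = f-inj (trans (sym (f′↦f x)) (trans (cong (embed U) eq) (f′↦f x′)))
  f′-edges : ∀ s → s ∈ᴸ edges H → ∃[ t ] (IsImage f′ s t × Q t)
  f′-edges s s∈H =
    let (t , s↦t , Pt) = f-edges s s∈H
        t⊆U : t ⊆ U
        t⊆U y∈t = let (x , fx≡y) = image⊆range s↦t y∈t in subst (_∈ U) fx≡y (f∈U x)
    in restrict U t , IsImage-restrict f′↦f s↦t , P⇒Q t⊆U Pt

LinkOf : ∀ {m} → Fin m → (Subset m → Set) → Subset m → Set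
LinkOf w P t = ∃[ T ] (P T × w ∈ T × T - w ≡ t)

x∉linkEdge : ∀ {k} {H : KGraph (suc k)} {x t} → LinkEdge H x t → x ∉ t
x∉linkEdge {H = H} (∣t∣≡k , t∪x∈H) x∈t =
  1+n≢n (trans (sym (All.lookup (uniform H) t∪x∈H)) (trans (cong ∣_∣ (x∈p⇒p∪⁅x⁆≡p x∈t)) ∣t∣≡k))

IsImage-∘-minus : ∀ {i j n} {g : Fin i → Fin j} {f : Fin j → Fin n} {x s t T} →
                  Injective _≡_ _≡_ f → x ∉ t →
                  IsImage g s t → IsImage f (t ∪ ⁅ x ⁆) T → IsImage (f ∘ g) s (T - f x)
IsImage-∘-minus {g = g} {f} {x} {s} {t} {T} f-inj x∉t s↦t t∪x↦T y = mk⇔ to′ from′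
  where
  to′ : y ∈ T - f x → ∃[ u ] (u ∈ s × f (g u) ≡ y)
  to′ y∈ with to (t∪x↦T y) (p─q⊆p T ⁅ f x ⁆ y∈)
  ... | z , z∈t∪x , fz≡y with x∈p∪q⁻ t ⁅ x ⁆ z∈t∪x
  ...   | inj₂ z∈⁅x⁆ =
    contradiction (trans (sym fz≡y) (cong f (x∈⁅y⁆⇒x≡y x z∈⁅x⁆))) (x∈p-y⇒x≢y y∈)
  ...   | inj₁ z∈t   = let (u , u∈s , gu≡z) = to (s↦t z) z∈t in u , u∈s , trans (cong f gu≡z) fz≡y
  from′ : ∃[ u ] (u ∈ s × f (g u) ≡ y) → y ∈ T - f x
  from′ (u , u∈s , refl) = x∈p∧x≢y⇒x∈p-y (from (t∪x↦T (f (g u))) (g u , p⊆p∪q ⁅ x ⁆ gu∈t , refl))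
                                          (λ fgu≡fx → x∉t (subst (_∈ t) (f-inj fgu≡fx) gu∈t))
    where
    gu∈t : g u ∈ t
    gu∈t = from (s↦t (g u)) (u , u∈s , refl)

copy-link : ∀ {k n} {H : KGraph (suc k)} {F : KGraph k} {f : Fin (V H) → Fin n} {P : Subset n → Set} {x} →
            IsCopy H f P → CopyIn F (LinkEdge H x) → CopyIn F (LinkOf (f x) P)
copy-link {H = H} {f = f} {x = x} (f-inj , f-edges) (g , g-inj , g-edges) = f ∘ g , g-inj ∘ f-inj , λ s s∈F →
  let (t , s↦t , t∈link@(_ , t∪x∈H)) = g-edges s s∈F
      (T , t∪x↦T , PT) = f-edges (t ∪ ⁅ x ⁆) t∪x∈H
      fx∈T = from (t∪x↦T (f x)) (x , q⊆p∪q t ⁅ x ⁆ (x∈⁅x⁆ x) , refl)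
  in T - f x , IsImage-∘-minus f-inj (x∉linkEdge {H = H} t∈link) s↦t t∪x↦T , T , PT , fx∈T , refl

least : ∀ {n} {P : Pred (Fin n) 0ℓ} → Decidable P → Maybe (Fin n)
least {zero}  P? = nothing
least {suc n} P? with P? zero
... | yes _ = just zero
... | no  _ = Maybe.map suc (least (P? ∘ suc))

least≡nothing⇒∀¬ : ∀ {n} {P : Pred (Fin n) 0ℓ} (P? : Decidable P) → least P? ≡ nothing → ∀ y → ¬ P y
least≡nothing⇒∀¬ {suc n} P? eq y with P? zero
least≡nothing⇒∀¬ {suc n} P? () y | yes _
... | no ¬P₀ with least (P? ∘ suc) in eq′
least≡nothing⇒∀¬ {suc n} P? ()  y       | no ¬P₀ | just _
least≡nothing⇒∀¬ {suc n} P? eq zero    | no ¬P₀ | nothing = ¬P₀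
least≡nothing⇒∀¬ {suc n} P? eq (suc y) | no ¬P₀ | nothing = least≡nothing⇒∀¬ (P? ∘ suc) eq′ y

least≡just⇒ : ∀ {n} {P : Pred (Fin n) 0ℓ} (P? : Decidable P) {w} → least P? ≡ just w →
              P w × (∀ {y} → y < w → ¬ P y)
least≡just⇒ {suc n} P? eq with P? zero
least≡just⇒ {suc n} P? refl | yes P₀ = P₀ , λ ()
... | no ¬P₀ with least (P? ∘ suc) in eq′
least≡just⇒ {suc n} P? refl | no ¬P₀ | just w =
  let (Pw , below) = least≡just⇒ (P? ∘ suc) eq′ in
  Pw , λ { {zero} _ → ¬P₀ ; {suc y} (s≤s y<w) → below y<w }

least≡just : ∀ {n} {P : Pred (Fin n) 0ℓ} (P? : Decidable P) {w} → P w → (∀ {y} → y < w → ¬ P y) →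
             least P? ≡ just w
least≡just {suc n} P? {w} Pw below with P? zero
least≡just {suc n} P? {zero}  Pw below | yes _  = refl
least≡just {suc n} P? {suc w} Pw below | yes P₀ = contradiction P₀ (below (s≤s z≤n))
least≡just {suc n} P? {zero}  Pw below | no ¬P₀ = contradiction Pw ¬P₀
least≡just {suc n} P? {suc w} Pw below | no ¬P₀
  rewrite least≡just (P? ∘ suc) {w} Pw (λ y<w → below (s≤s y<w)) = refl

module _ {k r} {ℋ : Family (suc k)} {F : KGraph k}
         (F⊆links : ∀ H → ℋ H → ∀ v → CopyIn F (LinkEdge H v))
         (G : KGraph (suc k)) (G→ℋ : Arrows G (suc r) ℋ) (U : Subset (V G))
         (bad : ∀ {w} → w ∉ U → BadColouring (suc r) (link G w) (_≡ F)) where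

  linkColouring : Fin (V G) → Colouring (suc r) G
  linkColouring w with w ∈? U
  ... | yes _   = λ _ → zero
  ... | no w∉U = proj₁ (bad w∉U)

  linkColouring-bad : ∀ {w} → w ∉ U → ¬ MonoCopy (link G w) (_≡ F) (linkColouring w)
  linkColouring-bad {w} w∉U with w ∈? U
  ... | yes w∈U  = contradiction w∈U w∉U
  ... | no w∉U′ = proj₂ (bad w∉U′)

  outside? : (T : Subset (V G)) → Decidable (λ y → y ∈ T × y ∉ U)
  outside? T y = y ∈? T ×-dec ¬? (y ∈? U)

  glue : Colouring (suc r) (induced G U) → Colouring (suc r) G
  glue c′ T with least (outside? T)
  ... | nothing = c′ (restrict U T)
  ... | just w  = linkColouring w (T - w)

  module _ (c′ : Colouring (suc r) (induced G U)) where

    glue-inside : ∀ {T} → T ⊆ U → glue c′ T ≡ c′ (restrict U T)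
    glue-inside {T} T⊆U with least (outside? T) in eq
    ... | nothing = refl
    ... | just w  = let ((w∈T , w∉U) , _) = least≡just⇒ (outside? T) eq in contradiction (T⊆U w∈T) w∉U

    glue-outside : ∀ {T w} → w ∈ T → w ∉ U → (∀ {y} → y < w → y ∈ T → y ∈ U) →
                   glue c′ T ≡ linkColouring w (T - w)
    glue-outside {T} w∈T w∉U below
      rewrite least≡just (outside? T) (w∈T , w∉U) (λ y<w (y∈T , y∉U) → y∉U (below y<w y∈T)) = refl

    module _ (H : KGraph (suc k)) {i} {f : Fin (V H) → Fin (V G)}
             (f-copy : IsCopy H f (MonoEdge G (glue c′) i)) where

      copy-in-induced : (∀ x → f x ∈ U) → CopyIn H (MonoEdge (induced G U) c′ i)
      copy-in-induced f∈U =
        copy-induced {H = H} U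
          (λ t⊆U (t∈G , glue≡i) → ∈-induced G U t∈G t⊆U , trans (sym (glue-inside t⊆U)) glue≡i)
          f∈U f-copy

      copy-in-link : ∀ {x} → f x ∉ U → (∀ {y} → y < f x → InRange f y → y ∈ U) →
                     CopyIn F (LinkEdge H x) → CopyIn F (MonoEdge (link G (f x)) (linkColouring (f x)) i)
      copy-in-link {x} fx∉U below F⊆link =
        copy-map F (λ (T , ((T∈G , glue≡i) , T⊆range) , fx∈T , T-fx≡t) →
                      subst (MonoEdge (link G (f x)) (linkColouring (f x)) i) T-fx≡t
                        ( ∈-link G (f x) T∈G fx∈T
                        , trans (sym (glue-outside fx∈T fx∉U (λ y<fx y∈T → below y<fx (T⊆range y∈T)))) glue≡i))
          (copy-link {H = H} {F = F} f-copy′ F⊆link)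
        where
        f-copy′ : IsCopy H f (λ T → MonoEdge G (glue c′) i T × (∀ {y} → y ∈ T → InRange f y))
        f-copy′ = IsCopy-map {F = H} (λ s↦t mono → mono , λ {y} → image⊆range s↦t {y}) f-copy

    ¬¬MonoCopy-induced : ¬ ¬ MonoCopy (induced G U) ℋ c′
    ¬¬MonoCopy-induced ¬mono with G→ℋ (glue c′)
    ... | H , H∈ℋ , i , f , f-copy with least (λ y → inRange? f y ×-dec ¬? (y ∈? U)) in eq
    ...   | nothing = ¬mono (H , H∈ℋ , i , copy-in-induced H f-copy λ x →
              decidable-stable (f x ∈? U) λ fx∉U → least≡nothing⇒∀¬ _ eq (f x) ((x , refl) , fx∉U))
    ...   | just w with least≡just⇒ _ eq
    ...     | ((x , refl) , fx∉U) , below = linkColouring-bad fx∉U (F , refl , i ,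
              copy-in-link H f-copy fx∉U
                (λ y<fx y∈range → decidable-stable (_ ∈? U) λ y∉U → below y<fx (y∈range , y∉U))
                (F⊆links H H∈ℋ x))

  induced-arrows : ¬ ¬ Arrows (induced G U) (suc r) ℋ
  induced-arrows ¬arrows =
    arrows-or-bad (induced G U) ℋ [ ¬arrows , (λ (c′ , ¬mono) → ¬¬MonoCopy-induced c′ ¬mono) ]′

indicator : ∀ {n} → Subset n → Fin n → ℕ
indicator T v = if does (v ∈? T) then 1 else 0

∑-indicator : ∀ {n} (T : Subset n) → ∑[ v < n ] indicator T v ≡ ∣ T ∣
∑-indicator []            = refl
∑-indicator (inside  ∷ T) = cong suc (∑-indicator T)
∑-indicator (outside ∷ T) = ∑-indicator T

length-filter-∈?-∷ : ∀ {n} (v : Fin n) T E →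
                     length (filter (v ∈?_) (T ∷ E)) ≡ indicator T v + length (filter (v ∈?_) E)
length-filter-∈?-∷ v T E with v ∈? T
... | yes _ = refl
... | no  _ = refl

∑-length-filter-∈? : ∀ {n k} (E : List (Subset n)) → All (λ T → ∣ T ∣ ≡ k) E →
                      ∑[ v < n ] length (filter (v ∈?_) E) ≡ length E * k
∑-length-filter-∈? {n}     []      []             = sum-replicate-zero n
∑-length-filter-∈? {n} {k} (T ∷ E) (∣T∣≡k ∷ ∣E∣≡k) = begin
  ∑[ v < n ] length (filter (v ∈?_) (T ∷ E))
    ≡⟨ sum-cong-≗ (λ v → length-filter-∈?-∷ v T E) ⟩
  ∑[ v < n ] (indicator T v + length (filter (v ∈?_) E))
    ≡⟨ ∑-distrib-+ (indicator T) (λ v → length (filter (v ∈?_) E)) ⟩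
  ∑[ v < n ] indicator T v + ∑[ v < n ] length (filter (v ∈?_) E)
    ≡⟨ cong₂ _+_ (trans (∑-indicator T) ∣T∣≡k) (∑-length-filter-∈? E ∣E∣≡k) ⟩
  k + length E * k ∎
  where open ≡-Reasoning

∣p∣*b≤∑ : ∀ {n b} (U : Subset n) (f : Fin n → ℕ) → (∀ {v} → v ∈ U → b ≤ f v) →
          ∣ U ∣ * b ≤ ∑[ v < n ] f v
∣p∣*b≤∑ []            f bound = z≤n
∣p∣*b≤∑ (inside  ∷ U) f bound = +-mono-≤ (bound here) (∣p∣*b≤∑ U (f ∘ suc) (bound ∘ there))
∣p∣*b≤∑ (outside ∷ U) f bound = ≤-trans (∣p∣*b≤∑ U (f ∘ suc) (bound ∘ there)) (m≤n+m _ (f zero))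

∣p∣*b≤e*k : ∀ {k b} (G : KGraph k) (U : Subset (V G)) → (∀ {v} → v ∈ U → b ≤ degree G v) →
            ∣ U ∣ * b ≤ e G * k
∣p∣*b≤e*k G U bound =
  ≤-trans (∣p∣*b≤∑ U (degree G) bound) (≤-reflexive (∑-length-filter-∈? (edges G) (uniform G)))

module _ {n} {A B : Fin n → Set} (d : ∀ v → A v ⊎ B v) where

  private
    isLeft : ∀ {v} → A v ⊎ B v → Bool
    isLeft = [ (λ _ → true) , (λ _ → false) ]′

  lefts : Subset n
  lefts = tabulate (isLeft ∘ d)

  ∈-lefts : ∀ {v} → v ∈ lefts → A v
  ∈-lefts {v} v∈ = fromLeft (d v) (trans (sym (lookup∘tabulate (isLeft ∘ d) v)) ([]=⇒lookup v∈))
    where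
    fromLeft : (s : A v ⊎ B v) → isLeft s ≡ true → A v
    fromLeft (inj₁ a) _ = a

  ∉-lefts : ∀ {v} → v ∉ lefts → B v
  ∉-lefts {v} v∉ =
    fromRight (d v) (λ isLeft≡true → v∉ (lookup⇒[]= v lefts (trans (lookup∘tabulate (isLeft ∘ d) v) isLeft≡true)))
    where
    fromRight : (s : A v ⊎ B v) → isLeft s ≢ true → B v
    fromRight (inj₁ _) notLeft = contradiction refl notLeft
    fromRight (inj₂ b) _       = b

theorem5p2 : (r k : ℕ) → 2 ≤ r → 2 ≤ k →
    (ℋ : Family k) (F : KGraph (k ∸ 1)) →
    (∀ H → ℋ H → ∀ v → CopyIn F (LinkEdge H v)) →
    ∀ a b c → IsSizeRamsey r ℋ a → IsSizeRamsey r (λ G → G ≡ F) b → IsRamsey r ℋ c →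
    b * c ≤ k * a
-- Only r ≥ 1 (there is a colour) and k ≥ 1 are needed.
theorem5p2 (suc r) (suc k) (s≤s _) (s≤s _) ℋ F F⊆links a b c ((G , G→ℋ , eG≡a) , _) (_ , b-min) (_ , c-min) =
  decidable-stable (b * c ≤? suc k * a) do
    d ← ¬¬-pull-Fin (V G) (λ v → arrows-or-bad (link G v) (_≡ F))
    G[U]→ℋ ← induced-arrows F⊆links G G→ℋ (lefts d) (∉-lefts d)
    return (begin
      b * c                ≡⟨ *-comm b c ⟩
      c * b                ≤⟨ *-monoˡ-≤ b (c-min (induced G (lefts d)) G[U]→ℋ) ⟩
      ∣ lefts d ∣ * b      ≤⟨ ∣p∣*b≤e*k G (lefts d) (λ {v} v∈U →
                                ≤-trans (b-min (link G v) (∈-lefts d v∈U)) (≤-reflexive (e-link G v))) ⟩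
      e G * suc k          ≡⟨ *-comm (e G) (suc k) ⟩
      suc k * e G          ≡⟨ cong (suc k *_) eG≡a ⟩
      suc k * a            ∎)
  where open ≤-Reasoning
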